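{- Let $\mathsf V$ be a subvariety of the variety $\mathsf{ROL}$ of residuated ortholattices such that there is a term $t(x,y)$ in the language $\{\wedge,\vee,\neg,0,1\}$ with $\mathsf V\models t(x,y)\approx x\backslash y$. Then every member of $\mathsf V$ is an orthomodular lattice (i.e., $\mathsf V$ is a variety of orthomodular lattices).
   Context: A bounded involutive lattice is a bounded lattice $(A,\wedge,\vee,0,1)$ with an order-reversing involution $\neg$. The Sasaki product is $x\cdot y:=x\wedge(\neg x\vee y)$. A residuated ortholattice is an algebra $(A,\wedge,\vee,\neg,\backslash,0,1)$ whose $\{\wedge,\vee,\neg,0,1\}$-reduct is a bounded involutive lattice and such that $x\cdot y\le z\iff y\le x\backslash z$ for all $x,y,z$; these form a variety $\mathsf{ROL}$. An ortholattice is a bounded involutive lattice satisfying $x\wedge\neg x\approx 0$; an orthomodular lattice is an ortholattice satisfying $x\le y\implies y\approx x\vee(y\wedge\neg x)$. -}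

module Defs where

open import Level using (Level; _⊔_) renaming (suc to lsuc)
open import Data.Nat using (ℕ)
open import Data.Fin using (Fin; zero; suc)
open import Data.Product using (_×_)
open import Relation.Binary.Core using (Rel)
open import Relation.Binary.Structures using (IsEquivalence)
open import Algebra.Lattice.Structures using (IsLattice)

infixr 7 _∧_
infixr 6 _∨_
infixr 5 _\\_
infix 8 ¬_

record ROL (c ℓ : Level) : Set (lsuc (c ⊔ ℓ)) where
  infix 4 _≈_ _≤_
  field
    Carrier : Set c
    _≈_     : Rel Carrier ℓ
    _∧_     : Carrier → Carrier → Carrier
    _∨_     : Carrier → Carrier → Carrier
    ¬_      : Carrier → Carrier
    _\\_    : Carrier → Carrier → Carrier
    𝟘       : Carrier
    𝟙       : Carrier

  _≤_ : Carrier → Carrier → Set ℓ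
  x ≤ y = (x ∧ y) ≈ x

  _·_ : Carrier → Carrier → Carrier
  x · y = x ∧ ((¬ x) ∨ y)

  field
    isLattice   : IsLattice _≈_ _∨_ _∧_
    ¬-cong      : ∀ {x y} → x ≈ y → (¬ x) ≈ (¬ y)
    \\-cong     : ∀ {x x' y y'} → x ≈ x' → y ≈ y' → (x \\ y) ≈ (x' \\ y')
    𝟘-least     : ∀ x → 𝟘 ≤ x
    𝟙-greatest  : ∀ x → x ≤ 𝟙
    ¬-involutive : ∀ x → (¬ (¬ x)) ≈ x
    ¬-antitone   : ∀ {x y} → x ≤ y → (¬ y) ≤ (¬ x)
    residuated-⇒ : ∀ x y z → (x · y) ≤ z → y ≤ (x \\ z)
    residuated-⇐ : ∀ x y z → y ≤ (x \\ z) → (x · y) ≤ z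

  open IsLattice isLattice public using (isEquivalence)

record IsOrthomodular {c ℓ} (A : ROL c ℓ) : Set (c ⊔ ℓ) where
  open ROL A
  field
    complement   : ∀ x → (x ∧ (¬ x)) ≈ 𝟘
    orthomodular : ∀ x y → x ≤ y → y ≈ (x ∨ (y ∧ (¬ x)))

data Term : Set where
  var  : ℕ → Term
  _∧_  : Term → Term → Term
  _∨_  : Term → Term → Term
  ¬_   : Term → Term
  _\\_ : Term → Term → Term
  𝟘 𝟙  : Term

eval : ∀ {c ℓ} (A : ROL c ℓ) → Term → (ℕ → ROL.Carrier A) → ROL.Carrier A
eval A (var i) ρ = ρ i
eval A (s ∧ t) ρ = ROL._∧_ A (eval A s ρ) (eval A t ρ)
eval A (s ∨ t) ρ = ROL._∨_ A (eval A s ρ) (eval A t ρ)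
eval A (¬ s) ρ = ROL.¬_ A (eval A s ρ)
eval A (s \\ t) ρ = ROL._\\_ A (eval A s ρ) (eval A t ρ)
eval A 𝟘 ρ = ROL.𝟘 A
eval A 𝟙 ρ = ROL.𝟙 A

-- A (sub)variety of ROL is presented by a set E of equations (Birkhoff);
-- A ∈ V  iff  A is an ROL satisfying every equation of E.
Equations : Set₁
Equations = Term → Term → Set

_⊨_ : ∀ {c ℓ} → ROL c ℓ → Equations → Set (c ⊔ ℓ)
A ⊨ E = ∀ s t → E s t → ∀ (ρ : ℕ → ROL.Carrier A) →
          ROL._≈_ A (eval A s ρ) (eval A t ρ)

data LTerm : Set where
  var : Fin 2 → LTerm
  _∧_ : LTerm → LTerm → LTerm
  _∨_ : LTerm → LTerm → LTerm
  ¬_  : LTerm → LTerm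
  𝟘 𝟙 : LTerm

evalL : ∀ {c ℓ} (A : ROL c ℓ) → LTerm → ROL.Carrier A → ROL.Carrier A → ROL.Carrier A
evalL A (var zero)    x y = x
evalL A (var (suc _)) x y = y
evalL A (s ∧ t) x y = ROL._∧_ A (evalL A s x y) (evalL A t x y)
evalL A (s ∨ t) x y = ROL._∨_ A (evalL A s x y) (evalL A t x y)
evalL A (¬ s)   x y = ROL.¬_ A (evalL A s x y)
evalL A 𝟘 x y = ROL.𝟘 A
evalL A 𝟙 x y = ROL.𝟙 A

{-# OPTIONS --safe #-}
-- Every residuated ortholattice is an ortholattice: x ∧ ¬x = x · 0 ≤ 0, since 0 ≤ x \ 0.
-- For orthomodularity, the elements z with z ≤ ¬y or y ≤ z form a {∧,∨,¬,0,1}-subalgebra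
-- containing y and 0, so a term t(y,0) in that language, and hence y \ 0, lies in it.
-- Given x ≤ y, put u = x ∨ (y ∧ ¬x) ≤ y. Then y · ¬u = y ∧ ¬u ≤ u ∧ ¬u = 0, so ¬u ≤ y \ 0.
-- If y \ 0 ≤ ¬y this gives y ≤ u; if y ≤ y \ 0 then y = y · y ≤ 0 ≤ u.
module Submission where

open import Defs using (ROL; IsOrthomodular; Equations; _⊨_; LTerm; evalL)
open import Level using (Level)
open import Data.Fin using (zero; suc)
open import Data.Sum using (_⊎_; inj₁; inj₂; [_,_]′)
open import Algebra.Lattice.Bundles using (Lattice)
import Algebra.Lattice.Properties.Lattice as LatticeProperties
import Relation.Binary.Lattice as OrderTheoretic
import Relation.Binary.Lattice.Properties.MeetSemilattice as MeetSemilatticeProperties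
import Relation.Binary.Reasoning.PartialOrder as ≤-Reasoning

module ResiduatedOrtholattice {c ℓ : Level} (A : ROL c ℓ) where
  open ROL A

  lattice : Lattice c ℓ
  lattice = record { isLattice = isLattice }

  open LatticeProperties lattice using (poset; ∨-∧-orderTheoreticLattice)
  open OrderTheoretic.Lattice ∨-∧-orderTheoreticLattice
    using ( module Eq; x≤x∨y; y≤x∨y; ∨-least; x∧y≤x; x∧y≤y; ∧-greatest
          ; ≤-respˡ-≈; ≤-respʳ-≈; meetSemilattice )
    renaming (_≤_ to _⊑_; refl to ⊑-refl; trans to ⊑-trans; antisym to ⊑-antisym)
  open MeetSemilatticeProperties meetSemilattice using (∧-monotonic)
  open ≤-Reasoning poset

  -- x ⊑ y unfolds to x ≈ x ∧ y, the symmetric form of the order x ≤ y of ROL.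
  ≤⇒⊑ : ∀ {x y} → x ≤ y → x ⊑ y
  ≤⇒⊑ = Eq.sym

  ⊑⇒≤ : ∀ {x y} → x ⊑ y → x ≤ y
  ⊑⇒≤ = Eq.sym

  𝟘-minimum : ∀ x → 𝟘 ⊑ x
  𝟘-minimum x = ≤⇒⊑ (𝟘-least x)

  𝟙-maximum : ∀ x → x ⊑ 𝟙
  𝟙-maximum x = ≤⇒⊑ (𝟙-greatest x)

  ¬-antitone-⊑ : ∀ {x y} → x ⊑ y → ¬ y ⊑ ¬ x
  ¬-antitone-⊑ x⊑y = ≤⇒⊑ (¬-antitone (⊑⇒≤ x⊑y))

  ¬-reflects-⊑ : ∀ {x y} → ¬ x ⊑ ¬ y → y ⊑ x
  ¬-reflects-⊑ {x} {y} ¬x⊑¬y =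
    ≤-respˡ-≈ (¬-involutive y) (≤-respʳ-≈ (¬-involutive x) (¬-antitone-⊑ ¬x⊑¬y))

  ⊑¬-swap : ∀ {x y} → x ⊑ ¬ y → y ⊑ ¬ x
  ⊑¬-swap {x} {y} x⊑¬y = ≤-respˡ-≈ (¬-involutive y) (¬-antitone-⊑ x⊑¬y)

  residuated : ∀ {x y z} → x · y ⊑ z → y ⊑ x \\ z
  residuated {x} {y} {z} xy⊑z = ≤⇒⊑ (residuated-⇒ x y z (⊑⇒≤ xy⊑z))

  unresiduated : ∀ {x y z} → y ⊑ x \\ z → x · y ⊑ z
  unresiduated {x} {y} {z} y⊑x\z = ≤⇒⊑ (residuated-⇐ x y z (⊑⇒≤ y⊑x\z))

  x∧¬x≈𝟘 : ∀ x → (x ∧ (¬ x)) ≈ 𝟘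
  x∧¬x≈𝟘 x = ⊑-antisym x∧¬x⊑𝟘 (𝟘-minimum (x ∧ (¬ x)))
    where
    x∧¬x⊑𝟘 : (x ∧ (¬ x)) ⊑ 𝟘
    x∧¬x⊑𝟘 = begin
      x ∧ (¬ x)         ≤⟨ ∧-monotonic ⊑-refl (x≤x∨y (¬ x) 𝟘) ⟩
      x ∧ ((¬ x) ∨ 𝟘)   ≤⟨ unresiduated (𝟘-minimum (x \\ 𝟘)) ⟩
      𝟘                 ∎

  x⊑x\\𝟘⇒x⊑𝟘 : ∀ {x} → x ⊑ x \\ 𝟘 → x ⊑ 𝟘
  x⊑x\\𝟘⇒x⊑𝟘 {x} x⊑x\𝟘 = begin
    x                 ≤⟨ ∧-greatest ⊑-refl (y≤x∨y (¬ x) x) ⟩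
    x ∧ ((¬ x) ∨ x)   ≤⟨ unresiduated x⊑x\𝟘 ⟩
    𝟘                 ∎

  Dichotomous : Carrier → Carrier → Set ℓ
  Dichotomous y z = z ⊑ ¬ y ⊎ y ⊑ z

  dichotomous-resp : ∀ {y z z'} → z ≈ z' → Dichotomous y z → Dichotomous y z'
  dichotomous-resp z≈z' (inj₁ z⊑¬y) = inj₁ (≤-respˡ-≈ z≈z' z⊑¬y)
  dichotomous-resp z≈z' (inj₂ y⊑z)  = inj₂ (≤-respʳ-≈ z≈z' y⊑z)

  dichotomous-∧ : ∀ {y z w} → Dichotomous y z → Dichotomous y w → Dichotomous y (z ∧ w)
  dichotomous-∧ (inj₁ z⊑¬y) _           = inj₁ (⊑-trans (x∧y≤x _ _) z⊑¬y)
  dichotomous-∧ (inj₂ _)    (inj₁ w⊑¬y) = inj₁ (⊑-trans (x∧y≤y _ _) w⊑¬y)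
  dichotomous-∧ (inj₂ y⊑z)  (inj₂ y⊑w)  = inj₂ (∧-greatest y⊑z y⊑w)

  dichotomous-∨ : ∀ {y z w} → Dichotomous y z → Dichotomous y w → Dichotomous y (z ∨ w)
  dichotomous-∨ (inj₂ y⊑z)  _           = inj₂ (⊑-trans y⊑z (x≤x∨y _ _))
  dichotomous-∨ (inj₁ _)    (inj₂ y⊑w)  = inj₂ (⊑-trans y⊑w (y≤x∨y _ _))
  dichotomous-∨ (inj₁ z⊑¬y) (inj₁ w⊑¬y) = inj₁ (∨-least z⊑¬y w⊑¬y)

  dichotomous-¬ : ∀ {y z} → Dichotomous y z → Dichotomous y (¬ z)
  dichotomous-¬ (inj₁ z⊑¬y) = inj₂ (⊑¬-swap z⊑¬y)
  dichotomous-¬ (inj₂ y⊑z)  = inj₁ (¬-antitone-⊑ y⊑z)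

  dichotomous-self : ∀ y → Dichotomous y y
  dichotomous-self y = inj₂ ⊑-refl

  dichotomous-𝟘 : ∀ y → Dichotomous y 𝟘
  dichotomous-𝟘 y = inj₁ (𝟘-minimum (¬ y))

  dichotomous-𝟙 : ∀ y → Dichotomous y 𝟙
  dichotomous-𝟙 y = inj₂ (𝟙-maximum y)

  orthomodular-law : ∀ {x y} → Dichotomous y (y \\ 𝟘) → x ⊑ y → y ≈ (x ∨ (y ∧ (¬ x)))
  orthomodular-law {x} {y} y\𝟘-dichotomous x⊑y = ⊑-antisym y⊑u u⊑y
    where
    u : Carrier
    u = x ∨ (y ∧ (¬ x))

    u⊑y : u ⊑ y
    u⊑y = ∨-least x⊑y (x∧y≤x y (¬ x))

    y·¬u⊑𝟘 : y · (¬ u) ⊑ 𝟘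
    y·¬u⊑𝟘 = begin
      y ∧ ((¬ y) ∨ (¬ u))   ≤⟨ ∧-monotonic ⊑-refl (∨-least (¬-antitone-⊑ u⊑y) ⊑-refl) ⟩
      y ∧ (¬ u)             ≤⟨ ∧-greatest (⊑-trans y∧¬u⊑y∧¬x (y≤x∨y x _)) (x∧y≤y y (¬ u)) ⟩
      u ∧ (¬ u)             ≈⟨ x∧¬x≈𝟘 u ⟩
      𝟘                     ∎
      where
      y∧¬u⊑y∧¬x : (y ∧ (¬ u)) ⊑ (y ∧ (¬ x))
      y∧¬u⊑y∧¬x = ∧-monotonic ⊑-refl (¬-antitone-⊑ (x≤x∨y x _))

    y⊑u : y ⊑ u
    y⊑u = [ (λ y\𝟘⊑¬y → ¬-reflects-⊑ (⊑-trans (residuated y·¬u⊑𝟘) y\𝟘⊑¬y))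
          , (λ y⊑y\𝟘 → ⊑-trans (x⊑x\\𝟘⇒x⊑𝟘 y⊑y\𝟘) (𝟘-minimum u))
          ]′ y\𝟘-dichotomous

module _ {c ℓ : Level} (A : ROL c ℓ) where
  open ResiduatedOrtholattice A
  open LTerm

  evalL-dichotomous : ∀ t {y z} → Dichotomous y z → Dichotomous y (evalL A t y z)
  evalL-dichotomous (var zero)    _ = dichotomous-self _
  evalL-dichotomous (var (suc _)) d = d
  evalL-dichotomous (s ∧ t) d = dichotomous-∧ (evalL-dichotomous s d) (evalL-dichotomous t d)
  evalL-dichotomous (s ∨ t) d = dichotomous-∨ (evalL-dichotomous s d) (evalL-dichotomous t d)
  evalL-dichotomous (¬ s)   d = dichotomous-¬ (evalL-dichotomous s d)
  evalL-dichotomous 𝟘 _ = dichotomous-𝟘 _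
  evalL-dichotomous 𝟙 _ = dichotomous-𝟙 _

theorem2p7 : ∀ {c ℓ : Level} (E : Equations) (t : LTerm) →
    (∀ (A : ROL c ℓ) → A ⊨ E → ∀ x y → ROL._≈_ A (evalL A t x y) (ROL._\\_ A x y)) →
    ∀ (A : ROL c ℓ) → A ⊨ E → IsOrthomodular A
theorem2p7 E t t≈\\ A A⊨E = record
  { complement   = x∧¬x≈𝟘
  ; orthomodular = λ x y x≤y → orthomodular-law (residual-𝟘-dichotomous y) (≤⇒⊑ x≤y)
  }
  where
  open ROL A
  open ResiduatedOrtholattice A

  residual-𝟘-dichotomous : ∀ y → Dichotomous y (y \\ 𝟘)
  residual-𝟘-dichotomous y =
    dichotomous-resp (t≈\\ A A⊨E y 𝟘) (evalL-dichotomous A t (dichotomous-𝟘 y))
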